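{- For every positive integer $k$, $$RR(\mathcal{E}(k,3)) = \begin{cases} 4 & \text{if } k \leq 5 \text{ or } k=7,\\ 6 & \text{if } k \in\{8,11\},\\ 9 & \text{if } k \in \{6,9,10\} \text{ or } k \geq 12.\end{cases}$$
   Context: For a positive integer $k$ and an integer $j > -k$, $\mathcal{E}(k,j)$ denotes the equation $x+y+kz=(k+j)w$. A $2$-coloring of $[1,N]=\{1,2,\dots,N\}$ is a map $\chi:[1,N]\to\{0,1\}$; a solution $(x,y,z,w)$ with $x,y,z,w\in[1,N]$ (not necessarily distinct) is monochromatic if $\chi(x)=\chi(y)=\chi(z)=\chi(w)$. For an equation $\mathcal{E}$, $RR(\mathcal{E})$ denotes the minimum positive integer $N$ such that every $2$-coloring of $[1,N]$ admits a monochromatic solution to $\mathcal{E}$ in $[1,N]$. -}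

module Defs where

open import Data.Nat using (ℕ; suc; _+_; _*_; _≤_; _<_)
open import Data.Bool using (Bool)
open import Data.Product using (Σ; _×_; ∃)
open import Relation.Binary.PropositionalEquality using (_≡_)
open import Relation.Nullary using (¬_)

InRange : ℕ → ℕ → Set
InRange N x = 1 ≤ x × x ≤ N

-- a 2-coloring of [1,N]: a map into Bool (values outside [1,N] are irrelevant)
Coloring : Set
Coloring = ℕ → Bool

-- the equation E(k,j) with j ≥ 0 (here j = 3): x + y + k z = (k + j) w
-- (j > -k holds automatically since j ≥ 0 and k ≥ 1)
SolE : ℕ → ℕ → ℕ → ℕ → ℕ → ℕ → Set
SolE k j x y z w = x + y + k * z ≡ (k + j) * w

MonoSol : ℕ → ℕ → ℕ → Coloring → Set
MonoSol k j N χ =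
  Σ ℕ λ x → Σ ℕ λ y → Σ ℕ λ z → Σ ℕ λ w →
    InRange N x × InRange N y × InRange N z × InRange N w ×
    SolE k j x y z w ×
    χ x ≡ χ y × χ y ≡ χ z × χ z ≡ χ w

Rado : ℕ → ℕ → ℕ → Set
Rado k j N = (χ : Coloring) → MonoSol k j N χ

IsRR : ℕ → ℕ → ℕ → Set
IsRR k j N = 1 ≤ N × Rado k j N × ((M : ℕ) → 1 ≤ M → M < N → ¬ Rado k j M)

-- Upper bounds are decided by exhausting the 2^N colourings of [1,N]; for N = 9 the search is
-- done once for x + y = 3w, whose solutions (x,y,z,w) give the solutions (x,y,w,w) of every
-- E(k,3). A single colouring χ₀ of [1,8] shows all the lower bounds: restricted to [1,3], [1,5]
-- or [1,8] it avoids E(k,3) for the relevant k. For 12 ≤ k ≤ 22 this is checked directly, while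
-- for k ≥ 23 every solution in [1,8] has z = w, so it is again a solution of x + y = 3w.
module Submission where

open import Defs
open import Data.Bool using (Bool; true; false)
open import Data.Bool.Properties using () renaming (_≟_ to _≟ᵇ_)
open import Data.Nat using (ℕ; zero; suc; _+_; _*_; _≤_; _≥_; _<_; _≤?_; _<?_; s≤s; z≤n)
open import Data.Nat.Properties
open import Data.Nat.Tactic.RingSolver using (solve-∀)
open import Data.Fin using (toℕ)
open import Data.Product using (∃; _×_; _,_)
open import Data.Sum using (_⊎_; inj₁; inj₂)
open import Data.Vec using (Vec; []; _∷_; tabulate)
open import Function using (_∘_)
open import Level using (0ℓ)
open import Relation.Binary using (tri<; tri≈; tri>)
open import Relation.Binary.PropositionalEquality using (_≡_; refl; sym; trans; cong; module ≡-Reasoning)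
open import Relation.Nullary using (Dec; yes; no; ¬_; contradiction)
open import Relation.Nullary.Decidable using (map′; _×-dec_; _⊎-dec_; _→-dec_; ¬?; from-yes; from-no)
open import Relation.Unary using (Pred; Decidable)

module _ {P : Pred ℕ 0ℓ} (P? : Decidable P) where

  anyInRange? : ∀ N → Dec (∃ λ x → InRange N x × P x)
  anyInRange? zero    = no λ { (x , (1≤x , x≤0) , _) → <⇒≱ 1≤x x≤0 }
  anyInRange? (suc N) = map′ to from (P? (suc N) ⊎-dec anyInRange? N)
    where
    to : P (suc N) ⊎ (∃ λ x → InRange N x × P x) → ∃ λ x → InRange (suc N) x × P x
    to (inj₁ p)                     = suc N , (s≤s z≤n , ≤-refl) , p
    to (inj₂ (x , (1≤x , x≤N) , p)) = x , (1≤x , m≤n⇒m≤1+n x≤N) , p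
    from : (∃ λ x → InRange (suc N) x × P x) → P (suc N) ⊎ (∃ λ x → InRange N x × P x)
    from (x , (1≤x , x≤1+N) , p) with m≤n⇒m<n∨m≡n x≤1+N
    ... | inj₁ (s≤s x≤N) = inj₂ (x , (1≤x , x≤N) , p)
    ... | inj₂ refl      = inj₁ p

-- The vector lists the colours of 1, …, n.
colouringOf : ∀ {n} → Vec Bool n → Coloring
colouringOf []       _             = false
colouringOf (b ∷ bs) zero          = false
colouringOf (b ∷ bs) (suc zero)    = b
colouringOf (b ∷ bs) (suc (suc x)) = colouringOf bs (suc x)

restrict : Coloring → (n : ℕ) → Vec Bool n
restrict χ n = tabulate (λ i → χ (suc (toℕ i)))

colouringOf-restrict : ∀ {n} χ {x} → InRange n x → colouringOf (restrict χ n) x ≡ χ x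
colouringOf-restrict {suc n} χ {suc zero}    _                = refl
colouringOf-restrict {suc n} χ {suc (suc x)} (_ , s≤s x+1≤n) =
  colouringOf-restrict (χ ∘ suc) (s≤s z≤n , x+1≤n)

∀-Vec? : ∀ {n} {P : Pred (Vec Bool n) 0ℓ} → Decidable P → Dec (∀ v → P v)
∀-Vec? {zero}  P? = map′ (λ { p [] → p }) (λ p → p []) (P? [])
∀-Vec? {suc n} P? =
  map′ (λ { (t , f) (true ∷ v) → t v ; (t , f) (false ∷ v) → f v })
       (λ p → p ∘ (true ∷_) , p ∘ (false ∷_))
       (∀-Vec? (P? ∘ (true ∷_)) ×-dec ∀-Vec? (P? ∘ (false ∷_)))

module _ (k j : ℕ) where

  monoSol? : ∀ N χ → Dec (MonoSol k j N χ)
  monoSol? N χ =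
    map′ to from
      (anyInRange? (λ x → anyInRange? (λ y → anyInRange? (λ z → anyInRange? (λ w →
         (x + y + k * z ≟ (k + j) * w) ×-dec
         (χ x ≟ᵇ χ y) ×-dec (χ y ≟ᵇ χ z) ×-dec (χ z ≟ᵇ χ w)) N) N) N) N)
    where
    to : _ → MonoSol k j N χ
    to (x , rx , y , ry , z , rz , w , rw , s) = x , y , z , w , rx , ry , rz , rw , s
    from : MonoSol k j N χ → _
    from (x , y , z , w , rx , ry , rz , rw , s) = x , rx , y , ry , z , rz , w , rw , s

  MonoSol-cong : ∀ {N χ χ′} → (∀ {x} → InRange N x → χ x ≡ χ′ x) →
                 MonoSol k j N χ → MonoSol k j N χ′
  MonoSol-cong {N = N} {χ} {χ′} χ≗χ′ (x , y , z , w , rx , ry , rz , rw , s , xy , yz , zw) =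
    x , y , z , w , rx , ry , rz , rw , s , transfer rx ry xy , transfer ry rz yz , transfer rz rw zw
    where
    transfer : ∀ {a b} → InRange N a → InRange N b → χ a ≡ χ b → χ′ a ≡ χ′ b
    transfer ra rb e = trans (sym (χ≗χ′ ra)) (trans e (χ≗χ′ rb))

  MonoSol-mono : ∀ {M N χ} → M ≤ N → MonoSol k j M χ → MonoSol k j N χ
  MonoSol-mono M≤N (x , y , z , w , rx , ry , rz , rw , rest) =
    x , y , z , w , widen rx , widen ry , widen rz , widen rw , rest
    where
    widen : ∀ {a} → InRange _ a → InRange _ a
    widen (1≤a , a≤M) = 1≤a , ≤-trans a≤M M≤N

  rado? : ∀ N → Dec (Rado k j N)
  rado? N = map′ to from (∀-Vec? (λ v → monoSol? N (colouringOf v)))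
    where
    to : (∀ (v : Vec Bool N) → MonoSol k j N (colouringOf v)) → Rado k j N
    to all χ = MonoSol-cong (colouringOf-restrict χ) (all (restrict χ N))
    from : Rado k j N → ∀ (v : Vec Bool N) → MonoSol k j N (colouringOf v)
    from rado v = rado (colouringOf v)

  IsRR-intro : ∀ {N} χ → Rado k j (suc N) → ¬ MonoSol k j N χ → IsRR k j (suc N)
  IsRR-intro χ rado avoids =
    s≤s z≤n , rado , λ { M _ (s≤s M≤N) radoM → avoids (MonoSol-mono M≤N (radoM χ)) }

[m+n]*o≡n*o+m*o : ∀ m n o → (m + n) * o ≡ n * o + m * o
[m+n]*o≡n*o+m*o m n o = trans (cong (_* o) (+-comm m n)) (*-distribʳ-+ o n m)

-- E(0,j) is the equation x + y = j w, in which z is free.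
SolE-lift : ∀ k j x y {z w} → SolE 0 j x y z w → SolE k j x y w w
SolE-lift k j x y {w = w} x+y+0≡jw = begin
  x + y + k * w ≡⟨ cong (_+ k * w) (trans (sym (+-identityʳ (x + y))) x+y+0≡jw) ⟩
  j * w + k * w ≡⟨ [m+n]*o≡n*o+m*o k j w ⟨
  (k + j) * w   ∎
  where open ≡-Reasoning

SolE-drop : ∀ k j x y {z w} → SolE k j x y w w → SolE 0 j x y z w
SolE-drop k j x y {w = w} sol =
  trans (+-identityʳ (x + y)) (+-cancelʳ-≡ (k * w) _ _ (trans sol ([m+n]*o≡n*o+m*o k j w)))

Rado-lift : ∀ k {j N} → Rado 0 j N → Rado k j N
Rado-lift k {j} rado χ with rado χ
... | x , y , z , w , rx , ry , rz , rw , s , xy , yz , zw =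
  x , y , w , w , rx , ry , rw , rw , SolE-lift k j x y {z} s , xy , trans yz zw , refl

SolE-z<w⇒3+k≤x+y : ∀ k x y {z w} → z < w → SolE k 3 x y z w → 3 + k ≤ x + y
SolE-z<w⇒3+k≤x+y k x y {z} z<w sol with d , refl ← m≤n⇒∃[o]m+o≡n z<w = begin
  3 + k                   ≡⟨ +-comm 3 k ⟩
  k + 3                   ≤⟨ m≤m*n (k + 3) (suc d) ⟩
  (k + 3) * suc d         ≤⟨ m≤n+m _ (3 * z) ⟩
  3 * z + (k + 3) * suc d ≡⟨ +-cancelʳ-≡ (k * z) _ _ (trans sol (expand k z d)) ⟨
  x + y                   ∎
  where
  open ≤-Reasoning
  expand : ∀ k z d → (k + 3) * (suc z + d) ≡ (3 * z + (k + 3) * suc d) + k * z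
  expand = solve-∀

SolE-w<z⇒x+y+k≤3w : ∀ k x y {z w} → w < z → SolE k 3 x y z w → x + y + k ≤ 3 * w
SolE-w<z⇒x+y+k≤3w k x y {w = w} w<z sol with d , refl ← m≤n⇒∃[o]m+o≡n w<z = begin
  x + y + k         ≤⟨ +-monoʳ-≤ (x + y) (m≤m*n k (suc d)) ⟩
  x + y + k * suc d ≡⟨ +-cancelʳ-≡ (k * w) _ _ (trans (sym (expand x y k w d)) (trans sol ([m+n]*o≡n*o+m*o k 3 w))) ⟩
  3 * w             ∎
  where
  open ≤-Reasoning
  expand : ∀ x y k w d → x + y + k * (suc w + d) ≡ (x + y + k * suc d) + k * w
  expand = solve-∀

-- Once 1 + k ≥ 3N, a nonzero multiple of k can be absorbed neither by x + y ≤ 2N nor by 3w ≤ 3N.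
SolE-diagonal : ∀ {k N x y z w} → 3 * N ≤ suc k → InRange N x → InRange N y → InRange N w →
                SolE k 3 x y z w → z ≡ w
SolE-diagonal {k} {N} {x} {y} {z} {w} 3N≤1+k (1≤x , x≤N) (1≤y , y≤N) (_ , w≤N) sol
  with <-cmp z w
... | tri≈ _ z≡w _ = z≡w
... | tri< z<w _ _ =
  contradiction (+-cancelʳ-≤ k 3 1 (≤-trans (SolE-z<w⇒3+k≤x+y k x y z<w sol) x+y≤1+k)) λ { (s≤s ()) }
  where
  x+y≤1+k : x + y ≤ suc k
  x+y≤1+k = ≤-trans (+-mono-≤ x≤N (≤-trans y≤N (m≤m+n N (N + 0)))) 3N≤1+k
... | tri> _ _ w<z =
  contradiction (+-cancelʳ-≤ k 2 1 (≤-trans 2+k≤x+y+k (≤-trans (SolE-w<z⇒x+y+k≤3w k x y w<z sol) 3w≤1+k)))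
    λ { (s≤s ()) }
  where
  2+k≤x+y+k : 2 + k ≤ x + y + k
  2+k≤x+y+k = +-monoˡ-≤ k (+-mono-≤ 1≤x 1≤y)
  3w≤1+k : 3 * w ≤ suc k
  3w≤1+k = ≤-trans (*-monoʳ-≤ 3 w≤N) 3N≤1+k

MonoSol-drop : ∀ {k N χ} → 3 * N ≤ suc k → MonoSol k 3 N χ → MonoSol 0 3 N χ
MonoSol-drop {k} 3N≤1+k (x , y , z , w , rx , ry , rz , rw , sol , colours)
  with refl ← SolE-diagonal {k} {z = z} 3N≤1+k rx ry rw sol =
  x , y , z , z , rx , ry , rz , rw , SolE-drop k 3 x y {z} {z} sol , colours

χ₀ : Coloring
χ₀ 2 = true
χ₀ 5 = true
χ₀ 6 = true
χ₀ 8 = true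
χ₀ _ = false

χ₀-avoids-E[k,3]-on-[1,8] : ∀ k → k ≡ 6 ⊎ k ≡ 9 ⊎ k ≡ 10 ⊎ k ≥ 12 → ¬ MonoSol k 3 8 χ₀
χ₀-avoids-E[k,3]-on-[1,8] 6  (inj₁ refl)               = from-no (monoSol? 6 3 8 χ₀)
χ₀-avoids-E[k,3]-on-[1,8] 9  (inj₂ (inj₁ refl))        = from-no (monoSol? 9 3 8 χ₀)
χ₀-avoids-E[k,3]-on-[1,8] 10 (inj₂ (inj₂ (inj₁ refl))) = from-no (monoSol? 10 3 8 χ₀)
χ₀-avoids-E[k,3]-on-[1,8] k  (inj₂ (inj₂ (inj₂ k≥12))) with k <? 23
... | yes k<23 = χ₀-avoids-[12,22] k<23 k≥12
  where
  χ₀-avoids-[12,22] : ∀ {k} → k < 23 → 12 ≤ k → ¬ MonoSol k 3 8 χ₀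
  χ₀-avoids-[12,22] = from-yes (allUpTo? (λ k → 12 ≤? k →-dec ¬? (monoSol? k 3 8 χ₀)) 23)
... | no k≮23 = from-no (monoSol? 0 3 8 χ₀) ∘ MonoSol-drop {k} {8} (s≤s (≮⇒≥ k≮23))

theorem5 : (k : ℕ) → 1 ≤ k →
    ((k ≤ 5 ⊎ k ≡ 7) → IsRR k 3 4) ×
    ((k ≡ 8 ⊎ k ≡ 11) → IsRR k 3 6) ×
    ((k ≡ 6 ⊎ k ≡ 9 ⊎ k ≡ 10 ⊎ k ≥ 12) → IsRR k 3 9)
theorem5 k 1≤k = rr4 , rr6 , rr9
  where
  rr4 : (k ≤ 5 ⊎ k ≡ 7) → IsRR k 3 4
  rr4 (inj₁ k≤5) = let rado , avoids = k∈[1,5] (s≤s k≤5) 1≤k in IsRR-intro k 3 χ₀ rado avoids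
    where
    k∈[1,5] : ∀ {k} → k < 6 → 1 ≤ k → Rado k 3 4 × ¬ MonoSol k 3 3 χ₀
    k∈[1,5] = from-yes (allUpTo? (λ k → 1 ≤? k →-dec rado? k 3 4 ×-dec ¬? (monoSol? k 3 3 χ₀)) 6)
  rr4 (inj₂ refl) = IsRR-intro k 3 χ₀ (from-yes (rado? 7 3 4)) (from-no (monoSol? 7 3 3 χ₀))
  rr6 : (k ≡ 8 ⊎ k ≡ 11) → IsRR k 3 6
  rr6 (inj₁ refl) = IsRR-intro k 3 χ₀ (from-yes (rado? 8 3 6)) (from-no (monoSol? 8 3 5 χ₀))
  rr6 (inj₂ refl) = IsRR-intro k 3 χ₀ (from-yes (rado? 11 3 6)) (from-no (monoSol? 11 3 5 χ₀))
  rr9 : (k ≡ 6 ⊎ k ≡ 9 ⊎ k ≡ 10 ⊎ k ≥ 12) → IsRR k 3 9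
  rr9 range = IsRR-intro k 3 χ₀ (Rado-lift k (from-yes (rado? 0 3 9))) (χ₀-avoids-E[k,3]-on-[1,8] k range)
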